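{- Let $n\ge 1$. Rowmotion on $\mathcal{IC}([n])$ has order dividing $2(n+2)$ when $n$ is odd and dividing $n+2$ when $n$ is even. Moreover its orbits are exactly the following: (i) one orbit of size $2$, namely $\{\emptyset,[n]\}$; (ii) for each integer $k$ with $1\le k<\frac n2$, an orbit of size $n+2$, \[\{[1,k],[2,k+1],\dots,[n-k+1,n],[1,n-k],[2,n-k+1],\dots,[k+1,n]\},\] (there are $\lfloor\frac{n-1}{2}\rfloor$ such orbits); (iii) when $n$ is even, one orbit of size $\frac{n+2}{2}$, namely $\{[1,\frac n2],[2,\frac n2+1],\dots,[\frac n2+1,n]\}$.
   Context: $[n]$ denotes the chain poset $1<2<\cdots<n$, and $[i,j]=\{i,i+1,\dots,j\}$. A subset $I$ of a poset $P$ is interval-closed if whenever $x,y\in I$ and $x\le z\le y$, then $z\in I$; $\mathcal{IC}(P)$ is the set of interval-closed subsets. For $x\in P$, the toggle $t_x$ sends $I$ to $I\triangle\{x\}$ if this set is interval-closed, and to $I$ otherwise. Rowmotion is $\mathrm{Row}=t_{x_1}\circ\cdots\circ t_{x_N}$ for a linear extension $(x_1,\dots,x_N)$ of $P$ (so $t_{x_N}$ is applied first). The order of rowmotion is the least common multiple of its orbit sizes. -}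

module Defs where

open import Data.Bool using (Bool; true; false; if_then_else_; not; _∧_)
open import Data.Nat using (ℕ; zero; suc; _+_; _≤ᵇ_)
open import Data.Fin using (Fin; toℕ; _≤_; _≤?_)
open import Data.Fin.Properties using (all?)
open import Data.Fin.Subset using (Subset; _∈_)
open import Data.Fin.Subset.Properties using (_∈?_)
open import Data.Vec using (updateAt; tabulate)
open import Data.List using (List; foldr)
import Data.List as L
open import Relation.Nullary using (Dec; does)
open import Relation.Nullary.Decidable using (_→-dec_)

-- The chain poset [n] is modelled by Fin n with its usual order;
-- element x : Fin n stands for the number toℕ x + 1.
-- Subsets of [n] are Data.Fin.Subset n (= Vec Bool n).

IntervalClosed : ∀ {n} → Subset n → Set
IntervalClosed {n} I =
  (x y z : Fin n) → x ∈ I → y ∈ I → x ≤ z → z ≤ y → z ∈ I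

intervalClosed? : ∀ {n} (I : Subset n) → Dec (IntervalClosed I)
intervalClosed? I =
  all? λ x → all? λ y → all? λ z →
    (x ∈? I) →-dec (y ∈? I) →-dec (x ≤? z) →-dec (z ≤? y) →-dec (z ∈? I)

flipAt : ∀ {n} → Fin n → Subset n → Subset n
flipAt x I = updateAt I x not

toggle : ∀ {n} → Fin n → Subset n → Subset n
toggle x I = if does (intervalClosed? (flipAt x I)) then flipAt x I else I

-- Rowmotion = t_{x_1} ∘ ⋯ ∘ t_{x_n} for the (unique) linear extension
-- (x_1,…,x_n) = (1,…,n) of the chain; t_{x_n} is applied first.
row : ∀ {n} → Subset n → Subset n
row {n} I = foldr toggle I (L.allFin n)

rowIter : ∀ {n} → ℕ → Subset n → Subset n
rowIter zero    I = I
rowIter (suc j) I = row (rowIter j I)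

-- the interval [i,j] = {i,…,j} ⊆ [n] (1-based; empty if j < i)
interval : ∀ {n} → ℕ → ℕ → Subset n
interval i j = tabulate λ z → (i ≤ᵇ suc (toℕ z)) ∧ (suc (toℕ z) ≤ᵇ j)

open import Data.Nat using (_∸_)
open import Data.Product using (Σ; ∃; _×_)
open import Data.List using (length; applyUpTo; _++_; _∷_; [])
open import Relation.Binary.PropositionalEquality using (_≡_)
import Data.List.Membership.Propositional as LM
open import Data.List.Relation.Unary.Unique.Propositional using (Unique)

OrbitIs : ∀ {n} → Subset n → List (Subset n) → ℕ → Set
OrbitIs {n} I S m =
  ((j : ℕ) → rowIter j I LM.∈ S)
  × ((J : Subset n) → J LM.∈ S → ∃ λ j → rowIter j I ≡ J)
  × Unique S
  × length S ≡ m

orbitEmptyFull : ∀ n → List (Subset n)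
orbitEmptyFull n = interval 1 0 ∷ interval 1 n ∷ []

orbitK : ∀ n → ℕ → List (Subset n)
orbitK n k =
  applyUpTo (λ i → interval (suc i) (i + k)) (suc (n ∸ k))
  ++ applyUpTo (λ i → interval (suc i) (i + (n ∸ k))) (suc k)

orbitHalf : ∀ n → ℕ → List (Subset n)
orbitHalf n m = applyUpTo (λ i → interval (suc i) (i + m)) (suc m)

{-# OPTIONS --safe #-}
-- An interval-closed subset of a chain is an interval: ∅, or [i+1, i+k]
-- for some k ≥ 1 (segment k i below). Rowmotion toggles from the top
-- down, and a toggle of an interval succeeds only at one of its ends.
-- Hence a proper interval [a+1, b] with b < n moves up to [a+2, b+1] (only
-- the toggles at b+1 and a+1 fire), whereas [a+1, n] is eaten from the top
-- and regrown from below into [1, a]. The k-element intervals therefore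
-- slide through their n−k+1 positions, wrap round to [1, n−k], slide
-- through its k+1 positions and wrap back to [1, k]: an orbit of size n+2
-- which, when n = 2k, is the same list traversed twice, so of size k+1.
-- Finally ∅ and [n] are exchanged.
module Submission where

open import Defs
open import Data.Bool using (true; false; not; _∧_; T; if_then_else_)
open import Data.Bool.Properties using (not-involutive; ∧-zeroʳ; T-≡; T-∧; ⇔→≡)
open import Data.Nat
  using (ℕ; zero; suc; _+_; _*_; _∸_; _⊓_; _⊔_; _≤_; _<_; _≤ᵇ_; z≤n; s≤s)
open import Data.Nat.Properties
open import Data.Nat.Divisibility
  using (_∣_; divides; divides-refl; ∣-refl; m∣m*n; n∣m*n; ∣m∣n⇒∣m+n)
open import Data.Fin using (Fin; toℕ; fromℕ<) renaming (zero to fzero; suc to fsuc)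
open import Data.Fin.Properties using (toℕ<n; toℕ-fromℕ<; toℕ-injective)
  renaming (_≟_ to _≟ᶠ_)
open import Data.Fin.Subset using (Subset)
open import Data.Vec using (lookup; _∷_; []; here; there)
open import Data.Vec.Properties
  using ( lookup∘tabulate; tabulate∘lookup; tabulate-cong; lookup∘updateAt
        ; lookup∘updateAt′; updateAt-updateAt-local; updateAt-id; []=⇒lookup; lookup⇒[]=
        ; ∷-injectiveʳ)
open import Data.List using (List; foldr; applyUpTo; _++_; length)
import Data.List as List
open import Data.List.Properties using (length-++; length-applyUpTo)
open import Data.List.Membership.Propositional.Properties
  using (∈-applyUpTo⁺; ∈-applyUpTo⁻; ∈-++⁺ˡ; ∈-++⁺ʳ; ∈-++⁻)
open import Data.List.Relation.Unary.Any using (here; there)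
open import Data.List.Relation.Unary.Unique.Propositional using (Unique)
open import Data.List.Relation.Unary.Unique.Propositional.Properties using (applyUpTo⁺₁; ++⁺)
import Data.List.Relation.Unary.All as All
import Data.List.Relation.Unary.AllPairs as AllPairs
open import Data.Product using (Σ; ∃; ∃₂; _×_; _,_; proj₁; proj₂)
open import Data.Sum using (_⊎_; inj₁; inj₂; [_,_]′)
open import Function using (_∘_; id; Equivalence; mk⇔)
open import Relation.Binary.PropositionalEquality
  using (_≡_; _≢_; refl; sym; trans; cong; cong₂; subst; module ≡-Reasoning)
open import Relation.Binary.Definitions using (tri<; tri≈; tri>)
open import Relation.Nullary using (¬_; yes; no; contradiction)
open import Relation.Nullary.Decidable using (dec-true; dec-false)
import Data.List.Membership.Propositional as LM

private
  variable
    n : ℕ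

≤ᵇ-true : ∀ {m k} → m ≤ k → (m ≤ᵇ k) ≡ true
≤ᵇ-true {m} {k} = dec-true (m ≤? k)

≤ᵇ-false : ∀ {m k} → k < m → (m ≤ᵇ k) ≡ false
≤ᵇ-false {m} {k} k<m = dec-false (m ≤? k) (<⇒≱ k<m)

i≤r⇒i+k≤n : ∀ {i r k} → i ≤ r → r + k ≡ n → i + k ≤ n
i≤r⇒i+k≤n {k = k} i≤r r+k≡n = ≤-trans (+-monoˡ-≤ k i≤r) (≤-reflexive r+k≡n)

point : ∀ {w} → w < n → Σ (Fin n) λ z → toℕ z ≡ w
point w<n = fromℕ< w<n , toℕ-fromℕ< w<n

lookup-ext : ∀ {I J : Subset n} → (∀ z → lookup I z ≡ lookup J z) → I ≡ J
lookup-ext {I = I} {J} I≗J =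
  trans (sym (tabulate∘lookup I)) (trans (tabulate-cong I≗J) (tabulate∘lookup J))

lookup-interval : ∀ p q (z : Fin n) →
  lookup (interval p q) z ≡ ((p ≤ᵇ suc (toℕ z)) ∧ (suc (toℕ z) ≤ᵇ q))
lookup-interval p q = lookup∘tabulate _

interval-∋ : ∀ {p q} (z : Fin n) → p ≤ suc (toℕ z) → suc (toℕ z) ≤ q →
  lookup (interval p q) z ≡ true
interval-∋ {p = p} {q} z p≤z z≤q
  rewrite lookup-interval p q z | ≤ᵇ-true p≤z | ≤ᵇ-true z≤q = refl

interval-∌-below : ∀ {p q} (z : Fin n) → suc (toℕ z) < p →
  lookup (interval p q) z ≡ false
interval-∌-below {p = p} {q} z z<p rewrite lookup-interval p q z | ≤ᵇ-false z<p = refl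

interval-∌-above : ∀ {p q} (z : Fin n) → q < suc (toℕ z) →
  lookup (interval p q) z ≡ false
interval-∌-above {p = p} {q} z q<z rewrite lookup-interval p q z | ≤ᵇ-false q<z = ∧-zeroʳ _

interval-∋⁻ : ∀ {p q} (z : Fin n) → lookup (interval p q) z ≡ true →
  p ≤ suc (toℕ z) × suc (toℕ z) ≤ q
interval-∋⁻ {p = p} {q} z z∈
  with Equivalence.to T-∧ (subst T (lookup-interval p q z) (Equivalence.from T-≡ z∈))
... | p≤ᵇz , z≤ᵇq = ≤ᵇ⇒≤ p _ p≤ᵇz , ≤ᵇ⇒≤ _ q z≤ᵇq

interval-intervalClosed : ∀ p q → IntervalClosed (interval {n} p q)
interval-intervalClosed p q x y z x∈ y∈ x≤z z≤y
  with interval-∋⁻ {p = p} {q} x ([]=⇒lookup x∈) | interval-∋⁻ {p = p} {q} y ([]=⇒lookup y∈)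
... | p≤x , _ | _ , y≤q =
  lookup⇒[]= z _ (interval-∋ z (≤-trans p≤x (s≤s x≤z)) (≤-trans (s≤s z≤y) y≤q))

interval-agree-off-top : ∀ {p q} (z : Fin n) → toℕ z ≢ q →
  lookup (interval p (suc q)) z ≡ lookup (interval p q) z
interval-agree-off-top {p = p} {q} z z≢q = ⇔→≡ (mk⇔ shrink grow)
  where
  shrink : lookup (interval p (suc q)) z ≡ true → lookup (interval p q) z ≡ true
  shrink z∈ with interval-∋⁻ {p = p} z z∈
  ... | p≤z , z≤1+q = interval-∋ z p≤z (≤∧≢⇒< (≤-pred z≤1+q) z≢q)
  grow : lookup (interval p q) z ≡ true → lookup (interval p (suc q)) z ≡ true
  grow z∈ with interval-∋⁻ {p = p} z z∈
  ... | p≤z , z≤q = interval-∋ z p≤z (m≤n⇒m≤1+n z≤q)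

interval-agree-off-bottom : ∀ {p q} (z : Fin n) → toℕ z ≢ p →
  lookup (interval (suc p) q) z ≡ lookup (interval (suc (suc p)) q) z
interval-agree-off-bottom {p = p} {q} z z≢p = ⇔→≡ (mk⇔ shrink grow)
  where
  shrink : lookup (interval (suc p) q) z ≡ true → lookup (interval (suc (suc p)) q) z ≡ true
  shrink z∈ with interval-∋⁻ {q = q} z z∈
  ... | 1+p≤z , z≤q = interval-∋ z (s≤s (≤∧≢⇒< (≤-pred 1+p≤z) (z≢p ∘ sym))) z≤q
  grow : lookup (interval (suc (suc p)) q) z ≡ true → lookup (interval (suc p) q) z ≡ true
  grow z∈ with interval-∋⁻ {q = q} z z∈
  ... | 2+p≤z , z≤q = interval-∋ z (≤-trans (n≤1+n _) 2+p≤z) z≤q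

lookup-flipAt-self : ∀ (y : Fin n) I → lookup (flipAt y I) y ≡ not (lookup I y)
lookup-flipAt-self y I = lookup∘updateAt y I

lookup-flipAt-other : ∀ {y z : Fin n} I → toℕ z ≢ toℕ y →
  lookup (flipAt y I) z ≡ lookup I z
lookup-flipAt-other {y = y} {z} I z≢y = lookup∘updateAt′ z y (z≢y ∘ cong toℕ) I

flipAt-exactly : ∀ {y : Fin n} {I J} → (∀ z → z ≢ y → lookup J z ≡ lookup I z) →
  lookup J y ≡ not (lookup I y) → flipAt y I ≡ J
flipAt-exactly {y = y} {I} {J} off at = lookup-ext pointwise
  where
  pointwise : ∀ z → lookup (flipAt y I) z ≡ lookup J z
  pointwise z with z ≟ᶠ y
  ... | yes refl = trans (lookup-flipAt-self y I) (sym at)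
  ... | no z≢y   = trans (lookup-flipAt-other I (z≢y ∘ toℕ-injective)) (sym (off z z≢y))

flipAt-inverse : ∀ {y : Fin n} {I J} → flipAt y I ≡ J → flipAt y J ≡ I
flipAt-inverse {y = y} {I} refl =
  trans (updateAt-updateAt-local y I (not-involutive (lookup I y))) (updateAt-id y I)

flipAt-interval-extendʳ : ∀ {p q} (y : Fin n) → toℕ y ≡ q → p ≤ suc q →
  flipAt y (interval p q) ≡ interval p (suc q)
flipAt-interval-extendʳ {p = p} y refl p≤1+y = flipAt-exactly
  (λ z z≢y → interval-agree-off-top {p = p} z (z≢y ∘ toℕ-injective))
  (trans (interval-∋ y p≤1+y ≤-refl) (cong not (sym (interval-∌-above {p = p} y ≤-refl))))

flipAt-interval-extendˡ : ∀ {p q} (y : Fin n) → toℕ y ≡ p → suc p ≤ q →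
  flipAt y (interval (suc (suc p)) q) ≡ interval (suc p) q
flipAt-interval-extendˡ {q = q} y refl 1+y≤q = flipAt-exactly
  (λ z z≢y → interval-agree-off-bottom {q = q} z (z≢y ∘ toℕ-injective))
  (trans (interval-∋ y ≤-refl 1+y≤q) (cong not (sym (interval-∌-below {q = q} y ≤-refl))))

toggle-flips : ∀ {y : Fin n} {I J} → flipAt y I ≡ J → IntervalClosed J → toggle y I ≡ J
toggle-flips {y = y} {I} refl J-closed =
  cong (if_then flipAt y I else I) (dec-true (intervalClosed? (flipAt y I)) J-closed)

toggle-fixes : ∀ {y : Fin n} {I} → ¬ IntervalClosed (flipAt y I) → toggle y I ≡ I
toggle-fixes {y = y} {I} ¬closed =
  cong (if_then flipAt y I else I) (dec-false (intervalClosed? (flipAt y I)) ¬closed)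

toggle-fixes-gap : ∀ {y : Fin n} {I} (x z x′ : Fin n) →
  toℕ x ≤ toℕ z → toℕ z ≤ toℕ x′ →
  lookup (flipAt y I) x ≡ true → lookup (flipAt y I) x′ ≡ true →
  lookup (flipAt y I) z ≡ false → toggle y I ≡ I
toggle-fixes-gap x z x′ x≤z z≤x′ x∈ x′∈ z∉ = toggle-fixes λ closed →
  contradiction (trans (sym z∉) ([]=⇒lookup
    (closed x x′ z (lookup⇒[]= x _ x∈) (lookup⇒[]= x′ _ x′∈) x≤z z≤x′))) λ ()

toggle-interval-extendʳ : ∀ {p q} (y : Fin n) → toℕ y ≡ q → p ≤ suc q →
  toggle y (interval p q) ≡ interval p (suc q)
toggle-interval-extendʳ {p = p} {q} y y≡q p≤1+q =
  toggle-flips (flipAt-interval-extendʳ y y≡q p≤1+q) (interval-intervalClosed p (suc q))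

toggle-interval-shrinkʳ : ∀ {p q} (y : Fin n) → toℕ y ≡ q → p ≤ suc q →
  toggle y (interval p (suc q)) ≡ interval p q
toggle-interval-shrinkʳ {p = p} {q} y y≡q p≤1+q =
  toggle-flips (flipAt-inverse (flipAt-interval-extendʳ y y≡q p≤1+q))
               (interval-intervalClosed p q)

toggle-interval-extendˡ : ∀ {p q} (y : Fin n) → toℕ y ≡ p → suc p ≤ q →
  toggle y (interval (suc (suc p)) q) ≡ interval (suc p) q
toggle-interval-extendˡ {p = p} {q} y y≡p 1+p≤q =
  toggle-flips (flipAt-interval-extendˡ y y≡p 1+p≤q) (interval-intervalClosed (suc p) q)

toggle-interval-shrinkˡ : ∀ {p q} (y : Fin n) → toℕ y ≡ p → suc p ≤ q →
  toggle y (interval (suc p) q) ≡ interval (suc (suc p)) q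
toggle-interval-shrinkˡ {p = p} {q} y y≡p 1+p≤q =
  toggle-flips (flipAt-inverse (flipAt-interval-extendˡ y y≡p 1+p≤q))
               (interval-intervalClosed (suc (suc p)) q)

toggle-interval-far-above : ∀ {p q} (y : Fin n) → p < q → q < toℕ y →
  toggle y (interval (suc p) q) ≡ interval (suc p) q
toggle-interval-far-above y p<q q<y
  with point (<-trans p<q (<-trans q<y (toℕ<n y))) | point (<-trans q<y (toℕ<n y))
... | x , refl | z , refl = toggle-fixes-gap x z y (<⇒≤ p<q) (<⇒≤ q<y)
  (trans (lookup-flipAt-other J (<⇒≢ (<-trans p<q q<y))) (interval-∋ x ≤-refl p<q))
  (trans (lookup-flipAt-self y J)
         (cong not (interval-∌-above {p = suc (toℕ x)} y (m<n⇒m<1+n q<y))))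
  (trans (lookup-flipAt-other J (<⇒≢ q<y)) (interval-∌-above {p = suc (toℕ x)} z ≤-refl))
  where J = interval (suc (toℕ x)) (toℕ z)

toggle-interval-inside : ∀ {p q} (y : Fin n) → p < toℕ y → toℕ y < q → q < n →
  toggle y (interval (suc p) (suc q)) ≡ interval (suc p) (suc q)
toggle-interval-inside y p<y y<q q<n with point (<-trans p<y (toℕ<n y)) | point q<n
... | x , refl | x′ , refl = toggle-fixes-gap x y x′ (<⇒≤ p<y) (<⇒≤ y<q)
  (trans (lookup-flipAt-other J (<⇒≢ p<y)) (interval-∋ x ≤-refl (s≤s p≤q)))
  (trans (lookup-flipAt-other J (>⇒≢ y<q)) (interval-∋ x′ (s≤s p≤q) ≤-refl))
  (trans (lookup-flipAt-self y J)
         (cong not (interval-∋ y (s≤s (<⇒≤ p<y)) (s≤s (<⇒≤ y<q)))))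
  where
  J   = interval (suc (toℕ x)) (suc (toℕ x′))
  p≤q = <⇒≤ (<-trans p<y y<q)

toggle-interval-far-below : ∀ {p q} (y : Fin n) → suc (toℕ y) < p → p < q → q ≤ n →
  toggle y (interval (suc p) q) ≡ interval (suc p) q
toggle-interval-far-below {q = q} y 1+y<p p<q q≤n
  with point (<-≤-trans p<q q≤n) | point (<-trans 1+y<p (<-≤-trans p<q q≤n))
... | x′ , refl | z , z≡1+y = toggle-fixes-gap y z x′
  (≤-trans (n≤1+n _) (≤-reflexive (sym z≡1+y))) (<⇒≤ z<x′)
  (trans (lookup-flipAt-self y J)
         (cong not (interval-∌-below {q = q} y (m<n⇒m<1+n 1+y<p))))
  (trans (lookup-flipAt-other J (>⇒≢ (<-trans (n<1+n _) 1+y<p)))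
         (interval-∋ x′ ≤-refl p<q))
  (trans (lookup-flipAt-other J (λ z≡y → 1+n≢n (trans (sym z≡1+y) z≡y)))
         (interval-∌-below {q = q} z (s≤s z<x′)))
  where
  J    = interval (suc (toℕ x′)) q
  z<x′ = ≤-trans (s≤s (≤-reflexive z≡1+y)) 1+y<p

-- Rowmotion toggles the elements from the top down, so Q t is meant to be
-- the set reached once every element of index ≥ t has been toggled.
row-sweep : (Q : ℕ → Subset n) → (∀ y → toggle y (Q (suc (toℕ y))) ≡ Q (toℕ y)) →
  row (Q n) ≡ Q 0
row-sweep {n} Q step = sweep n 0 id refl (λ _ → refl)
  where
  sweep : ∀ m s (f : Fin m → Fin n) → s + m ≡ n → (∀ i → toℕ (f i) ≡ s + toℕ i) →
    foldr toggle (Q n) (List.tabulate f) ≡ Q s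
  sweep zero    s f s+0≡n   _    = cong Q (trans (sym s+0≡n) (+-identityʳ s))
  sweep (suc m) s f s+1+m≡n f≡s+ = begin
    toggle (f fzero) (foldr toggle (Q n) (List.tabulate (f ∘ fsuc)))
      ≡⟨ cong (toggle (f fzero)) (sweep m (suc s) (f ∘ fsuc)
                                        (trans (sym (+-suc s m)) s+1+m≡n)
                                        (λ i → trans (f≡s+ (fsuc i)) (+-suc s (toℕ i)))) ⟩
    toggle (f fzero) (Q (suc s))
      ≡⟨ subst (λ t → toggle (f fzero) (Q (suc t)) ≡ Q t)
               (trans (f≡s+ fzero) (+-identityʳ s)) (step (f fzero)) ⟩
    Q s ∎
    where open ≡-Reasoning

row-interval-wrap : ∀ {a} → a ≤ n → row (interval {n} (suc a) n) ≡ interval 1 a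
row-interval-wrap {n} {a} a≤n = trans (cong row (sym (Q-above a≤n))) (row-sweep Q step)
  where
  Q : ℕ → Subset n
  Q t = interval (suc (t ⊓ a)) (t ⊔ a)
  Q-above : ∀ {t} → a ≤ t → Q t ≡ interval (suc a) t
  Q-above a≤t = cong₂ (interval ∘ suc) (m≥n⇒m⊓n≡n a≤t) (m≥n⇒m⊔n≡m a≤t)
  Q-below : ∀ {t} → t ≤ a → Q t ≡ interval (suc t) a
  Q-below t≤a = cong₂ (interval ∘ suc) (m≤n⇒m⊓n≡m t≤a) (m≤n⇒m⊔n≡n t≤a)
  step : ∀ y → toggle y (Q (suc (toℕ y))) ≡ Q (toℕ y)
  step y with a ≤? toℕ y
  ... | yes a≤y rewrite Q-above (m≤n⇒m≤1+n a≤y) | Q-above a≤y =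
    toggle-interval-shrinkʳ y refl (s≤s a≤y)
  ... | no a≰y rewrite Q-below (≰⇒> a≰y) | Q-below (<⇒≤ (≰⇒> a≰y)) =
    toggle-interval-extendˡ y refl (≰⇒> a≰y)

row-interval-shift : ∀ {a b} → a < b → b < n →
  row (interval {n} (suc a) b) ≡ interval (suc (suc a)) (suc b)
row-interval-shift {n} {a} {b} a<b b<n =
  trans (cong row (sym (Q-above b<n))) (trans (row-sweep Q step) (Q-below z≤n))
  where
  Q : ℕ → Subset n
  Q t = if t ≤ᵇ a then interval (suc (suc a)) (suc b)
        else if t ≤ᵇ b then interval (suc a) (suc b)
        else interval (suc a) b
  Q-below : ∀ {t} → t ≤ a → Q t ≡ interval (suc (suc a)) (suc b)
  Q-below t≤a rewrite ≤ᵇ-true t≤a = refl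
  Q-middle : ∀ {t} → a < t → t ≤ b → Q t ≡ interval (suc a) (suc b)
  Q-middle a<t t≤b rewrite ≤ᵇ-false a<t | ≤ᵇ-true t≤b = refl
  Q-above : ∀ {t} → b < t → Q t ≡ interval (suc a) b
  Q-above b<t rewrite ≤ᵇ-false (<-trans a<b b<t) | ≤ᵇ-false b<t = refl
  step : ∀ y → toggle y (Q (suc (toℕ y))) ≡ Q (toℕ y)
  step y with <-cmp (toℕ y) b
  ... | tri> _ _ b<y rewrite Q-above (m<n⇒m<1+n b<y) | Q-above b<y =
    toggle-interval-far-above y a<b b<y
  ... | tri≈ _ y≡b _
    rewrite Q-above (s≤s (≤-reflexive (sym y≡b)))
          | Q-middle (<-≤-trans a<b (≤-reflexive (sym y≡b))) (≤-reflexive y≡b) =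
    toggle-interval-extendʳ y y≡b (s≤s (<⇒≤ a<b))
  ... | tri< y<b _ _ with <-cmp (toℕ y) a
  ...   | tri> _ _ a<y rewrite Q-middle (m<n⇒m<1+n a<y) y<b | Q-middle a<y (<⇒≤ y<b) =
    toggle-interval-inside y a<y y<b b<n
  ...   | tri≈ _ y≡a _
    rewrite Q-middle (s≤s (≤-reflexive (sym y≡a))) y<b | Q-below (≤-reflexive y≡a) =
    toggle-interval-shrinkˡ y y≡a (s≤s (<⇒≤ a<b))
  ...   | tri< y<a _ _ rewrite Q-below y<a | Q-below (<⇒≤ y<a) =
    toggle-interval-far-below y (s≤s y<a) (s≤s a<b) b<n

segment : ℕ → ℕ → Subset n
segment k i = interval (suc i) (i + k)

row-segment-shift : ∀ {k i} → 1 ≤ k → i + k < n →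
  row (segment {n} k i) ≡ segment k (suc i)
row-segment-shift {i = i} 1≤k i+k<n = row-interval-shift (m<m+n i 1≤k) i+k<n

row-segment-wrap : ∀ k i → i + k ≡ n → row (segment {n} k i) ≡ segment i 0
row-segment-wrap k i refl = row-interval-wrap (m≤m+n i k)

interval-1-0≡segment-0 : interval {n} 1 0 ≡ segment 0 n
interval-1-0≡segment-0 {n} = lookup-ext λ z →
  trans (interval-∌-above {p = 1} z (s≤s z≤n))
        (sym (interval-∌-below {q = n + 0} z (s≤s (toℕ<n z))))

row-empty : row (interval {n} 1 0) ≡ interval 1 n
row-empty {n} = trans (cong row interval-1-0≡segment-0) (row-segment-wrap 0 n (+-identityʳ n))

row-full : row (interval {n} 1 n) ≡ interval 1 0
row-full {n} = row-segment-wrap n 0 refl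

rowIter-+ : ∀ j m (I : Subset n) → rowIter (j + m) I ≡ rowIter j (rowIter m I)
rowIter-+ zero    m I = refl
rowIter-+ (suc j) m I = cong row (rowIter-+ j m I)

rowIter-comm : ∀ j m (I : Subset n) → rowIter j (rowIter m I) ≡ rowIter m (rowIter j I)
rowIter-comm j m I =
  trans (sym (rowIter-+ j m I)) (trans (cong (λ l → rowIter l I) (+-comm j m)) (rowIter-+ m j I))

rowIter-periodic : ∀ {p j} {I : Subset n} → p ∣ j → rowIter p I ≡ I → rowIter j I ≡ I
rowIter-periodic {p = p} {I = I} (divides-refl q) periodic = multiple q
  where
  multiple : ∀ q → rowIter (q * p) I ≡ I
  multiple zero    = refl
  multiple (suc q) =
    trans (rowIter-+ p (q * p) I) (trans (cong (rowIter p) (multiple q)) periodic)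

rowIter-segment : ∀ {k} i → 1 ≤ k → i + k ≤ n → rowIter i (segment {n} k 0) ≡ segment k i
rowIter-segment zero    _   _     = refl
rowIter-segment (suc i) 1≤k i+k<n =
  trans (cong row (rowIter-segment i 1≤k (<⇒≤ i+k<n))) (row-segment-shift 1≤k i+k<n)

rowIter-segment-wrap : ∀ {k r} → 1 ≤ k → r + k ≡ n →
  rowIter (suc r) (segment {n} k 0) ≡ segment r 0
rowIter-segment-wrap {k = k} {r} 1≤k r+k≡n =
  trans (cong row (rowIter-segment r 1≤k (≤-reflexive r+k≡n))) (row-segment-wrap k r r+k≡n)

rowIter-n+2-segment-0 : ∀ {k r} → 1 ≤ k → 1 ≤ r → k + r ≡ n →
  rowIter (n + 2) (segment {n} k 0) ≡ segment k 0
rowIter-n+2-segment-0 {k = k} {r} 1≤k 1≤r refl = begin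
  rowIter ((k + r) + 2) (segment k 0)
    ≡⟨ cong (λ l → rowIter l (segment k 0)) n+2≡1+k+1+r ⟩
  rowIter (suc k + suc r) (segment k 0)
    ≡⟨ rowIter-+ (suc k) (suc r) _ ⟩
  rowIter (suc k) (rowIter (suc r) (segment k 0))
    ≡⟨ cong (rowIter (suc k)) (rowIter-segment-wrap 1≤k (+-comm r k)) ⟩
  rowIter (suc k) (segment r 0)
    ≡⟨ rowIter-segment-wrap 1≤r refl ⟩
  segment k 0 ∎
  where
  open ≡-Reasoning
  n+2≡1+k+1+r : (k + r) + 2 ≡ suc k + suc r
  n+2≡1+k+1+r = trans (+-assoc k r 2) (trans (cong (k +_) (+-comm r 2)) (+-suc k (suc r)))

rowIter-n+2-segment : ∀ {k i} → 1 ≤ k → k < n → i + k ≤ n →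
  rowIter (n + 2) (segment {n} k i) ≡ segment k i
rowIter-n+2-segment {n} {k} {i} 1≤k k<n i+k≤n = begin
  rowIter (n + 2) (segment k i)                  ≡⟨ cong (rowIter (n + 2)) (sym reach) ⟩
  rowIter (n + 2) (rowIter i (segment k 0))      ≡⟨ rowIter-comm (n + 2) i _ ⟩
  rowIter i (rowIter (n + 2) (segment k 0))      ≡⟨ cong (rowIter i) period ⟩
  rowIter i (segment k 0)                        ≡⟨ reach ⟩
  segment k i                                    ∎
  where
  open ≡-Reasoning
  reach  = rowIter-segment i 1≤k i+k≤n
  period = rowIter-n+2-segment-0 1≤k (m<n⇒0<n∸m k<n) (m+[n∸m]≡n (<⇒≤ k<n))

intervalClosed-tail : ∀ {b} {I : Subset n} → IntervalClosed (b ∷ I) → IntervalClosed I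
intervalClosed-tail closed x y z x∈ y∈ x≤z z≤y
  with closed (fsuc x) (fsuc y) (fsuc z) (there x∈) (there y∈) (s≤s x≤z) (s≤s z≤y)
... | there z∈ = z∈

true∷segment-not-closed : ∀ {k i} → 1 ≤ k → suc i + k ≤ n →
  ¬ IntervalClosed (true ∷ segment {n} k (suc i))
true∷segment-not-closed {zero} _ () _
true∷segment-not-closed {suc n} {k} {i} 1≤k i+k<n closed
  with point (<-≤-trans (m<m+n (suc i) 1≤k) i+k<n)
... | y , y≡1+i with closed fzero (fsuc y) (fsuc fzero) here (there y∈) z≤n (s≤s z≤n)
  where
  y∈ = lookup⇒[]= y _ (interval-∋ y (s≤s (≤-reflexive (sym y≡1+i)))
                                    (≤-trans (s≤s (≤-reflexive y≡1+i)) (m<m+n (suc i) 1≤k)))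
... | there 0∈ with []=⇒lookup 0∈
... | ()

intervalClosed⇒segment : ∀ (I : Subset n) → IntervalClosed I →
  I ≡ interval 1 0 ⊎ ∃₂ λ k i → 1 ≤ k × i + k ≤ n × I ≡ segment k i
intervalClosed⇒segment []      _      = inj₁ refl
intervalClosed⇒segment (b ∷ I) closed
  with intervalClosed⇒segment I (intervalClosed-tail closed)
intervalClosed⇒segment (false ∷ _) _ | inj₁ refl = inj₁ refl
intervalClosed⇒segment (false ∷ _) _ | inj₂ (k , i , 1≤k , i+k≤n , refl) =
  inj₂ (k , suc i , 1≤k , s≤s i+k≤n , refl)
intervalClosed⇒segment (true ∷ _)  _ | inj₁ refl =
  inj₂ (1 , 0 , ≤-refl , s≤s z≤n , refl)
intervalClosed⇒segment (true ∷ _)  _ | inj₂ (k , zero , 1≤k , k≤n , refl) =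
  inj₂ (suc k , 0 , s≤s z≤n , s≤s k≤n , refl)
intervalClosed⇒segment (true ∷ _)  closed | inj₂ (k , suc i , 1≤k , i+k<n , refl) =
  contradiction closed (true∷segment-not-closed 1≤k i+k<n)

data IntervalShape {n} : Subset n → Set where
  empty  : IntervalShape (interval 1 0)
  full   : IntervalShape (interval 1 n)
  proper : ∀ k i → 1 ≤ k → k < n → i + k ≤ n → IntervalShape (segment k i)

intervalShape : ∀ {I : Subset n} → IntervalClosed I → IntervalShape I
intervalShape {n} {I} closed with intervalClosed⇒segment I closed
... | inj₁ refl = empty
... | inj₂ (k , i , 1≤k , i+k≤n , refl) with m≤n⇒m<n∨m≡n (≤-trans (m≤n+m k i) i+k≤n)
...   | inj₁ k<n = proper k i 1≤k k<n i+k≤n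
...   | inj₂ refl with n≤0⇒n≡0 (+-cancelʳ-≤ n i 0 i+k≤n)
...     | refl = full

rowIter-2-empty : rowIter 2 (interval {n} 1 0) ≡ interval 1 0
rowIter-2-empty = trans (cong row row-empty) row-full

rowIter-2-full : rowIter 2 (interval {n} 1 n) ≡ interval 1 n
rowIter-2-full = trans (cong row row-full) row-empty

intervalClosed-periodic : ∀ {I : Subset n} → IntervalClosed I →
  rowIter 2 I ≡ I ⊎ rowIter (n + 2) I ≡ I
intervalClosed-periodic closed with intervalShape closed
... | empty                     = inj₁ rowIter-2-empty
... | full                      = inj₁ rowIter-2-full
... | proper k i 1≤k k<n i+k≤n = inj₂ (rowIter-n+2-segment 1≤k k<n i+k≤n)

rowIter-2*[n+2] : ∀ {I : Subset n} → IntervalClosed I → rowIter (2 * (n + 2)) I ≡ I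
rowIter-2*[n+2] {n} closed =
  [ rowIter-periodic {p = 2} (m∣m*n (n + 2)) , rowIter-periodic {p = n + 2} (n∣m*n 2) ]′
    (intervalClosed-periodic closed)

rowIter-n+2-even : ∀ {m} {I : Subset n} → n ≡ 2 * m → IntervalClosed I →
  rowIter (n + 2) I ≡ I
rowIter-n+2-even {m = m} n≡2m closed =
  [ rowIter-periodic {p = 2} (∣m∣n⇒∣m+n 2∣n ∣-refl) , id ]′ (intervalClosed-periodic closed)
  where 2∣n = divides m (trans n≡2m (*-comm 2 m))

segment-0-injective : ∀ {k k′} → k ≤ n → k′ ≤ n →
  segment {n} k 0 ≡ segment k′ 0 → k ≡ k′
segment-0-injective {zero}  z≤n z≤n _ = refl
segment-0-injective {suc n} {zero}  {zero}   _ _ _ = refl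
segment-0-injective {suc n} {zero}  {suc k′} _ _ ()
segment-0-injective {suc n} {suc k} {zero}   _ _ ()
segment-0-injective {suc n} {suc k} {suc k′} (s≤s k≤n) (s≤s k′≤n) eq =
  cong suc (segment-0-injective k≤n k′≤n (∷-injectiveʳ eq))

segment-injective : ∀ {k k′ i j} → 1 ≤ k → 1 ≤ k′ → i + k ≤ n → j + k′ ≤ n →
  segment {n} k i ≡ segment k′ j → i ≡ j × k ≡ k′
segment-injective {i = zero} {zero} _ _ k≤n k′≤n eq =
  refl , segment-0-injective k≤n k′≤n eq
segment-injective {suc n} {suc k}      {i = zero}  {suc j} _ _ _ _ ()
segment-injective {suc n} {k′ = suc k′} {i = suc i} {zero}  _ _ _ _ ()
segment-injective {suc n} {i = suc i} {suc j} 1≤k 1≤k′ (s≤s i+k≤n) (s≤s j+k′≤n) eq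
  with segment-injective 1≤k 1≤k′ i+k≤n j+k′≤n (∷-injectiveʳ eq)
... | refl , k≡k′ = refl , k≡k′

-- orbitK n k and orbitHalf n m are, definitionally,
-- translates k (n ∸ k) ++ translates (n ∸ k) k and translates m m.
translates : ℕ → ℕ → List (Subset n)
translates k r = applyUpTo (segment k) (suc r)

segment-∈-translates : ∀ k r {i} → i ≤ r → segment {n} k i LM.∈ translates k r
segment-∈-translates k r i≤r = ∈-applyUpTo⁺ (segment k) (s≤s i≤r)

row-translates : ∀ {k r} {J : Subset n} → 1 ≤ k → r + k ≡ n → J LM.∈ translates k r →
  row J LM.∈ translates k r ⊎ row J ≡ segment r 0
row-translates {k = k} {r} 1≤k r+k≡n J∈ with ∈-applyUpTo⁻ (segment k) J∈
... | i , i<1+r , refl with m≤n⇒m<n∨m≡n (≤-pred i<1+r)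
...   | inj₁ i<r = inj₁ (subst (LM._∈ _) (sym (row-segment-shift 1≤k (i≤r⇒i+k≤n i<r r+k≡n)))
                                          (segment-∈-translates k r i<r))
...   | inj₂ refl = inj₂ (row-segment-wrap k r r+k≡n)

translates-reachable : ∀ {k r} {J : Subset n} → 1 ≤ k → r + k ≡ n →
  J LM.∈ translates k r → ∃ λ i → rowIter i (segment k 0) ≡ J
translates-reachable {k = k} 1≤k r+k≡n J∈ with ∈-applyUpTo⁻ (segment k) J∈
... | i , i<1+r , refl = i , rowIter-segment i 1≤k (i≤r⇒i+k≤n (≤-pred i<1+r) r+k≡n)

translates-unique : ∀ {k r} → 1 ≤ k → r + k ≡ n → Unique (translates {n} k r)
translates-unique {k = k} {r} 1≤k r+k≡n = applyUpTo⁺₁ (segment k) (suc r) λ i<j j<1+r eq →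
  <⇒≢ i<j (proj₁ (segment-injective 1≤k 1≤k (fits (<-trans i<j j<1+r)) (fits j<1+r) eq))
  where
  fits : ∀ {i} → i < suc r → i + k ≤ _
  fits i<1+r = i≤r⇒i+k≤n (≤-pred i<1+r) r+k≡n

iterates-∈ : ∀ {I : Subset n} {S} → (∀ {J} → J LM.∈ S → row J LM.∈ S) → I LM.∈ S →
  ∀ j → rowIter j I LM.∈ S
iterates-∈ row-closed I∈ zero    = I∈
iterates-∈ row-closed I∈ (suc j) = row-closed (iterates-∈ row-closed I∈ j)

translates-orbit : ∀ {m} → 1 ≤ m → m + m ≡ n →
  OrbitIs (segment {n} m 0) (translates m m) (suc m)
translates-orbit {m = m} 1≤m m+m≡n =
  iterates-∈ row-closed (segment-∈-translates m m z≤n) ,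
  (λ _ → translates-reachable 1≤m m+m≡n) ,
  translates-unique 1≤m m+m≡n ,
  length-applyUpTo (segment m) (suc m)
  where
  row-closed : ∀ {J} → J LM.∈ translates m m → row J LM.∈ translates m m
  row-closed J∈ with row-translates 1≤m m+m≡n J∈
  ... | inj₁ row-J∈ = row-J∈
  ... | inj₂ row-J≡ = subst (LM._∈ _) (sym row-J≡) (segment-∈-translates m m z≤n)

translates-orbit₂ : ∀ {k r} → 1 ≤ k → 1 ≤ r → k + r ≡ n → k ≢ r →
  OrbitIs (segment {n} k 0) (translates k r ++ translates r k) (n + 2)
translates-orbit₂ {n} {k} {r} 1≤k 1≤r k+r≡n k≢r =
  iterates-∈ row-closed (∈-++⁺ˡ (segment-∈-translates k r z≤n)) , reachable ,
  ++⁺ (translates-unique 1≤k r+k≡n) (translates-unique 1≤r k+r≡n) disjoint , length-F++G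
  where
  r+k≡n = trans (+-comm r k) k+r≡n
  F = translates {n} k r
  G = translates {n} r k
  row-closed : ∀ {J} → J LM.∈ F ++ G → row J LM.∈ F ++ G
  row-closed J∈ with ∈-++⁻ F J∈
  ... | inj₁ J∈F with row-translates 1≤k r+k≡n J∈F
  ...   | inj₁ row-J∈F = ∈-++⁺ˡ row-J∈F
  ...   | inj₂ row-J≡  =
    ∈-++⁺ʳ F (subst (LM._∈ G) (sym row-J≡) (segment-∈-translates r k z≤n))
  row-closed J∈ | inj₂ J∈G with row-translates 1≤r k+r≡n J∈G
  ...   | inj₁ row-J∈G = ∈-++⁺ʳ F row-J∈G
  ...   | inj₂ row-J≡  =
    ∈-++⁺ˡ (subst (LM._∈ F) (sym row-J≡) (segment-∈-translates k r z≤n))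
  reachable : ∀ J → J LM.∈ F ++ G → ∃ λ j → rowIter j (segment k 0) ≡ J
  reachable J J∈ with ∈-++⁻ F J∈
  ... | inj₁ J∈F = translates-reachable 1≤k r+k≡n J∈F
  ... | inj₂ J∈G with translates-reachable 1≤r k+r≡n J∈G
  ...   | i , refl = i + suc r ,
    trans (rowIter-+ i (suc r) _) (cong (rowIter i) (rowIter-segment-wrap 1≤k r+k≡n))
  disjoint : ∀ {J} → ¬ (J LM.∈ F × J LM.∈ G)
  disjoint (J∈F , J∈G) with ∈-applyUpTo⁻ (segment k) J∈F | ∈-applyUpTo⁻ (segment r) J∈G
  ... | i , i<1+r , refl | j , j<1+k , eq = k≢r (proj₂ (segment-injective 1≤k 1≤r
    (i≤r⇒i+k≤n (≤-pred i<1+r) r+k≡n) (i≤r⇒i+k≤n (≤-pred j<1+k) k+r≡n) eq))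
  length-F++G : length (F ++ G) ≡ n + 2
  length-F++G = begin
    length (F ++ G)      ≡⟨ length-++ F ⟩
    length F + length G  ≡⟨ cong₂ _+_ (length-applyUpTo (segment k) (suc r))
                                      (length-applyUpTo (segment r) (suc k)) ⟩
    suc r + suc k        ≡⟨ cong suc (+-suc r k) ⟩
    suc (suc (r + k))    ≡⟨ cong (suc ∘ suc) r+k≡n ⟩
    2 + n                ≡⟨ +-comm 2 n ⟩
    n + 2                ∎
    where open ≡-Reasoning

orbitEmptyFull-isOrbit : 1 ≤ n → OrbitIs (interval {n} 1 0) (orbitEmptyFull n) 2
orbitEmptyFull-isOrbit {suc n} _ = iterates-∈ row-closed (here refl) , reachable , unique , refl
  where
  row-closed : ∀ {J} → J LM.∈ orbitEmptyFull (suc n) → row J LM.∈ orbitEmptyFull (suc n)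
  row-closed (here refl)         = there (here row-empty)
  row-closed (there (here refl)) = here row-full
  reachable : ∀ J → J LM.∈ orbitEmptyFull (suc n) → ∃ λ j → rowIter j (interval 1 0) ≡ J
  reachable _ (here refl)         = 0 , refl
  reachable _ (there (here refl)) = 1 , row-empty
  unique : Unique (orbitEmptyFull (suc n))
  unique = ((λ ()) All.∷ All.[]) AllPairs.∷ (All.[] AllPairs.∷ AllPairs.[])

2*k<n⇒k<n∸k : ∀ {k n} → 2 * k < n → k < n ∸ k
2*k<n⇒k<n∸k {k} {n} 2k<n =
  m+n≤o⇒m≤o∸n (suc k) (subst (_≤ n) (cong (suc ∘ (k +_)) (+-identityʳ k)) 2k<n)

n<2*k⇒2*[n∸k]<n : ∀ {k n} → k ≤ n → n < 2 * k → 2 * (n ∸ k) < n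
n<2*k⇒2*[n∸k]<n {k} {n} k≤n n<2k = begin-strict
  2 * (n ∸ k)        ≡⟨ cong ((n ∸ k) +_) (+-identityʳ (n ∸ k)) ⟩
  (n ∸ k) + (n ∸ k)  <⟨ +-monoʳ-< (n ∸ k) n∸k<k ⟩
  (n ∸ k) + k        ≡⟨ m∸n+n≡m k≤n ⟩
  n                  ∎
  where
  open ≤-Reasoning
  n∸k<k : n ∸ k < k
  n∸k<k = +-cancelʳ-< k (n ∸ k) k (begin-strict
    (n ∸ k) + k  ≡⟨ m∸n+n≡m k≤n ⟩
    n            <⟨ n<2k ⟩
    2 * k        ≡⟨ cong (k +_) (+-identityʳ k) ⟩
    k + k        ∎)

orbitK-isOrbit : ∀ {k} → 1 ≤ k → 2 * k < n →
  OrbitIs (interval {n} 1 k) (orbitK n k) (n + 2)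
orbitK-isOrbit {n} {k} 1≤k 2k<n =
  translates-orbit₂ {k = k} {n ∸ k} 1≤k (≤-trans 1≤k (<⇒≤ k<n∸k)) (m+[n∸m]≡n k≤n) (<⇒≢ k<n∸k)
  where
  k<n∸k = 2*k<n⇒k<n∸k {k} 2k<n
  k≤n   = ≤-trans (m≤m+n k (k + 0)) (<⇒≤ 2k<n)

orbitHalf-isOrbit : ∀ {m} → 1 ≤ n → n ≡ 2 * m →
  OrbitIs (interval {n} 1 m) (orbitHalf n m) (suc m)
orbitHalf-isOrbit {m = suc m} _ refl =
  translates-orbit {m = suc m} (s≤s z≤n) (cong (suc m +_) (sym (+-identityʳ (suc m))))

segment-∈-orbit : ∀ {k i} → 1 ≤ k → k < n → i ≤ n ∸ k →
  (∃ λ k′ → 1 ≤ k′ × 2 * k′ < n × segment k i LM.∈ orbitK n k′)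
  ⊎ (∃ λ m → n ≡ 2 * m × segment k i LM.∈ orbitHalf n m)
segment-∈-orbit {n} {k} {i} 1≤k k<n i≤n∸k with <-cmp (2 * k) n
... | tri< 2k<n _ _ =
  inj₁ (k , 1≤k , 2k<n , ∈-++⁺ˡ (segment-∈-translates k (n ∸ k) i≤n∸k))
... | tri≈ _ 2k≡n _ =
  inj₂ (k , sym 2k≡n , subst (λ r → segment k i LM.∈ translates k r) n∸k≡k
                             (segment-∈-translates k (n ∸ k) i≤n∸k))
  where
  n∸k≡k : n ∸ k ≡ k
  n∸k≡k = +-cancelʳ-≡ k (n ∸ k) k
    (trans (m∸n+n≡m (<⇒≤ k<n)) (trans (sym 2k≡n) (cong (k +_) (+-identityʳ k))))
... | tri> _ _ n<2k =
  inj₁ (n ∸ k , m<n⇒0<n∸m k<n , n<2*k⇒2*[n∸k]<n (<⇒≤ k<n) n<2k ,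
        ∈-++⁺ʳ (translates (n ∸ k) (n ∸ (n ∸ k)))
          (subst (λ l → segment {n} k i LM.∈ translates l (n ∸ k))
                 (sym (m∸[m∸n]≡n (<⇒≤ k<n))) (segment-∈-translates k (n ∸ k) i≤n∸k)))

intervalClosed-∈-orbit : ∀ {I : Subset n} → IntervalClosed I →
  I LM.∈ orbitEmptyFull n
  ⊎ (∃ λ k → 1 ≤ k × 2 * k < n × I LM.∈ orbitK n k)
  ⊎ (∃ λ m → n ≡ 2 * m × I LM.∈ orbitHalf n m)
intervalClosed-∈-orbit closed with intervalShape closed
... | empty                     = inj₁ (here refl)
... | full                      = inj₁ (there (here refl))
... | proper k i 1≤k k<n i+k≤n = inj₂ (segment-∈-orbit 1≤k k<n (m+n≤o⇒m≤o∸n i i+k≤n))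

theorem3p2 : (n : ℕ) → 1 ≤ n →
    -- order of rowmotion on IC([n]) divides 2(n+2) for n odd
    ((m : ℕ) → n ≡ suc (2 * m) →
      (I : Subset n) → IntervalClosed I → rowIter (2 * (n + 2)) I ≡ I)
    -- order divides n+2 for n even
    × ((m : ℕ) → n ≡ 2 * m →
      (I : Subset n) → IntervalClosed I → rowIter (n + 2) I ≡ I)
    -- (i) orbit {∅,[n]} of size 2
    × OrbitIs (interval 1 0) (orbitEmptyFull n) 2
    -- (ii) for 1 ≤ k < n/2 an orbit of size n+2
    × ((k : ℕ) → 1 ≤ k → 2 * k < n →
      OrbitIs (interval 1 k) (orbitK n k) (n + 2))
    -- (iii) for n = 2m an orbit of size (n+2)/2 = m+1
    × ((m : ℕ) → n ≡ 2 * m →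
      OrbitIs (interval 1 m) (orbitHalf n m) (suc m))
    -- these are all the orbits: every interval-closed set lies in one of them
    × ((I : Subset n) → IntervalClosed I →
      (I LM.∈ orbitEmptyFull n)
      ⊎ (∃ λ k → 1 ≤ k × 2 * k < n × I LM.∈ orbitK n k)
      ⊎ (∃ λ m → n ≡ 2 * m × I LM.∈ orbitHalf n m))
theorem3p2 n 1≤n =
    (λ _ _ _ → rowIter-2*[n+2])
  , (λ m n≡2m _ → rowIter-n+2-even {m = m} n≡2m)
  , orbitEmptyFull-isOrbit 1≤n
  , (λ _ → orbitK-isOrbit)
  , (λ _ → orbitHalf-isOrbit 1≤n)
  , (λ _ → intervalClosed-∈-orbit)
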